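{- Let $G$ be a finite abelian group and $t$ an integer relatively prime to $|G|$. Let $X\in \mathbb{Z}[G]$ satisfy $X^{(t)}=X$, $|X|=n$ and $XX^{(-1)}=n^2$ for some integer $n\geq 1$, and let $a_0$ be the coefficient of the identity in $X$. Let $x=\gcd(\operatorname{ord}_q(t): q \text{ a prime dividing } |G|)$, and suppose that either $x>\max\{n,n-a_0\}$, or $x\geq n$ and $x$ is even. Then $X=n$.
   Context: For $X=\sum_g x_g g\in\mathbb{Z}[G]$ and an integer $s$, $X^{(s)}=\sum_g x_g g^s$ and $|X|=\sum_g x_g$. $\operatorname{ord}_q(t)$ is the multiplicative order of $t$ modulo $q$. -}

module Defs where

open import Data.Nat as ℕ using (ℕ; zero; suc)
open import Data.Nat.GCD using (gcd)
open import Data.Nat.Primality using (prime?)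
open import Data.Nat.Divisibility using () renaming (_∣?_ to _∣ℕ?_)
open import Data.Integer as ℤ using (ℤ; +_; -[1+_])
open import Data.Integer.Divisibility.Signed using (_∣?_)
open import Data.Fin using (Fin; _≟_)
open import Data.List using (List; []; _∷_; filter; map; foldr; upTo)
open import Data.Product using (_×_)
open import Relation.Nullary using (yes; no; Dec)
open import Relation.Nullary.Decidable using (_×-dec_)
open import Relation.Binary.PropositionalEquality using (_≡_)
open import Algebra.Structures using (IsAbelianGroup)

-- A finite abelian group of order m, presented on the carrier Fin m
-- (every finite abelian group is isomorphic to one of this form).
record FinAbGroup (m : ℕ) : Set where
  field
    _∙_ : Fin m → Fin m → Fin m
    ε   : Fin m
    _⁻¹ : Fin m → Fin m
    isAbelianGroup : IsAbelianGroup _≡_ _∙_ ε _⁻¹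

Σℤ : ∀ {m} → (Fin m → ℤ) → ℤ
Σℤ {zero}  f = + 0
Σℤ {suc m} f = f Fin.zero ℤ.+ Σℤ (λ i → f (Fin.suc i))
  where import Data.Fin as Fin

-- The group ring ℤ[G]: an element is its coefficient function g ↦ x_g.
ZG : ℕ → Set
ZG m = Fin m → ℤ

module GroupRing {m : ℕ} (G : FinAbGroup m) where
  open FinAbGroup G

  powℕ : Fin m → ℕ → Fin m
  powℕ g zero    = ε
  powℕ g (suc k) = g ∙ powℕ g k

  powℤ : Fin m → ℤ → Fin m
  powℤ g (+ k)      = powℕ g k
  powℤ g -[1+ k ]   = (powℕ g (suc k)) ⁻¹

  _·_ : ZG m → ZG m → ZG m
  (X · Y) g = Σℤ (λ h → X h ℤ.* Y ((h ⁻¹) ∙ g))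

  -- X^{(s)} = Σ_h x_h h^s : coefficient of g is Σ_{h : h^s = g} x_h
  twist : ℤ → ZG m → ZG m
  twist s X g = Σℤ (λ h → Dec-if (powℤ h s ≟ g) (X h))
    where
    Dec-if : ∀ {P : Set} → Dec P → ℤ → ℤ
    Dec-if (yes _) z = z
    Dec-if (no _)  z = + 0

  aug : ZG m → ℤ
  aug X = Σℤ X

  scalar : ℤ → ZG m
  scalar c g with g ≟ ε
  ... | yes _ = c
  ... | no  _ = + 0

  _≋_ : ZG m → ZG m → Set
  X ≋ Y = ∀ g → X g ≡ Y g

-- ord_q(t): least k with 1 ≤ k ≤ q and q ∣ t^k - 1 (0 if none exists;
-- when gcd(t,q)=1 and q ≥ 2 this is the multiplicative order of t mod q).
ordFrom : ℕ → ℤ → ℕ → ℕ → ℕ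
ordFrom q t k zero    = 0
ordFrom q t k (suc fuel) with (+ q) ∣? (t ℤ.^ k ℤ.- + 1)
... | yes _ = k
... | no  _ = ordFrom q t (suc k) fuel

ord : ℕ → ℤ → ℕ
ord q t = ordFrom q t 1 q

primeDivisors : ℕ → List ℕ
primeDivisors m = filter (λ q → prime? q ×-dec (q ∣ℕ? m)) (upTo (suc m))

-- gcd(ord_q(t) : q prime, q ∣ m)   (gcd of the empty family is 0)
ordGcd : ℕ → ℤ → ℕ
ordGcd m t = foldr gcd 0 (map (λ q → ord q t) (primeDivisors m))

-- The twist by t permutes G through h ↦ hᵗ, and X^{(t)} = X says that the
-- coefficients aₕ of X are constant on its orbits. If h ≠ 1 and h^{tʲ} = h, then
-- tʲ − 1 kills h, so it shares a prime q with |G|, and ord_q(t) ∣ j: every orbit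
-- other than {1} has length divisible by x. Summing over orbits, x divides
-- S = Σ_{h≠1} aₕ = n − a₀ and 2x divides Σ_{h≠1} aₕ(aₕ − 1) = (n² − a₀²) − S
-- = S (2n − S − 1), using Σ aₕ² = n², the identity coefficient of X X^{(−1)}.
-- That sum is nonnegative, so 0 ≤ S < 2n. Then S < x forces S = 0, and so does
-- an even x ≥ n: S is a multiple of x below 2x, and S = x would make the odd
-- number 2n − x − 1 even. Finally a₀ = n leaves Σ_{h≠1} aₕ² = 0.
module Submission where

open import Algebra.Bundles using (AbelianGroup)
import Algebra.Properties.AbelianGroup as AbelianGroupProperties
import Algebra.Properties.CommutativeMonoid.Mult as CommutativeMonoidMult
import Algebra.Properties.CommutativeMonoid.Sum as CommutativeMonoidSum
open import Data.Empty using (⊥-elim)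
open import Data.Fin as Fin using (Fin; _≟_; punchIn; toℕ)
open import Data.Fin.Permutation using (Permutation; permutation)
open import Data.Fin.Properties
  using (punchInᵢ≢i; nonZeroIndex; pigeonhole; toℕ≤pred[n]; fromℕ<-injective)
open import Data.Integer as ℤ
  using (ℤ; +_; -[1+_]; ∣_∣; 0ℤ; 1ℤ; -1ℤ; _+_; _-_; _*_; -_; _^_; _≤_; _<_)
import Data.Integer.Divisibility.Signed as ℤ
open import Data.Integer.DivMod using (_%ℕ_; _/ℕ_; n%ℕd<d; a≡a%ℕn+[a/ℕn]*n)
import Data.Integer.Properties as ℤ
import Algebra.Properties.AbelianGroup ℤ.+-0-abelianGroup as ℤ+
open import Algebra.Properties.Semiring.Sum ℤ.+-*-semiring
  using (sum; sum-cong-≗; sum-remove; sum-replicate-zero; ∑-distrib-+; *-distribˡ-sum)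
open import Data.Integer.Tactic.RingSolver using (solve-∀)
open import Data.List using (List; []; _∷_; foldr; allFin)
open import Data.List.Membership.Propositional using (_∈_)
open import Data.List.Membership.Propositional.Properties using (∈-allFin; ∈-filter⁺; ∈-map⁺; ∈-upTo⁺)
open import Data.List.Relation.Unary.All using () renaming (_∷_ to _∷ᴬ_)
open import Data.List.Relation.Unary.Any using (here; there)
open import Data.Nat as ℕ using (ℕ; zero; suc; pred; _∸_; NonZero; z≤n; s≤s)
open import Data.Nat.Coprimality as Coprime using (Coprime; coprime⇒gcd≡1; coprime-divisor)
open import Data.Nat.Divisibility using (_∣_; divides)
import Data.Nat.Divisibility as ℕ
open import Data.Nat.DivMod using (_%_; _/_)
import Data.Nat.DivMod as ℕ
open import Data.Nat.GCD using (gcd; gcd-GCD; gcd[m,n]∣m; gcd[m,n]∣n; gcd[m,n]≢0; module Bézout)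
open import Data.Nat.GeneralisedArithmetic using (fold; fold-+)
open import Data.Nat.Induction using (<-rec)
open import Data.Nat.ListAction using (product)
open import Data.Nat.Primality using (Prime; prime?; euclidsLemma; prime⇒nonZero; prime⇒nonTrivial)
open import Data.Nat.Primality.Factorisation using (factorise)
import Data.Nat.Properties as ℕ
open import Data.Product using (_×_; _,_; ∃-syntax; proj₁; proj₂)
open import Data.Sum using (_⊎_; inj₁; inj₂; [_,_]′; map₁)
open import Data.Vec.Functional using (Vector; removeAt; replicate; updateAt)
open import Data.Vec.Functional.Properties using (updateAt-updates; updateAt-minimal)
open import Function using (id; _∘_; const; flip)
open import Level using (0ℓ)
open import Relation.Binary.PropositionalEquality
open import Relation.Nullary using (¬_; yes; no)
open import Relation.Nullary.Decidable using (_×-dec_)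
open import Relation.Unary using (Decidable)

open import Defs

Σℤ≡sum : ∀ {m} (f : Vector ℤ m) → Σℤ f ≡ sum f
Σℤ≡sum {zero}  f = refl
Σℤ≡sum {suc m} f = cong (_+_ (f Fin.zero)) (Σℤ≡sum (f ∘ Fin.suc))

sum-supportedAt : ∀ {m} (f : Vector ℤ m) e → (∀ b → b ≢ e → f b ≡ 0ℤ) → sum f ≡ f e
sum-supportedAt {suc m} f e f≡0 = begin
  sum f                       ≡⟨ sum-remove f ⟩
  f e + sum (removeAt f e)    ≡⟨ cong (_+_ (f e)) (sum-cong-≗ {m} (λ i → f≡0 (punchIn e i) (punchInᵢ≢i e i))) ⟩
  f e + sum (replicate m 0ℤ)  ≡⟨ cong (_+_ (f e)) (sum-replicate-zero m) ⟩
  f e + 0ℤ                    ≡⟨ ℤ.+-identityʳ (f e) ⟩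
  f e                         ∎
  where open ≡-Reasoning

sum-∘-split : ∀ {m} (F : ℤ → ℤ) → F 0ℤ ≡ 0ℤ → ∀ (f : Vector ℤ m) e →
              sum (F ∘ f) ≡ F (f e) + sum (F ∘ updateAt f e (const 0ℤ))
sum-∘-split {suc m} F F0≡0 f e = begin
  sum (F ∘ f)
    ≡⟨ sum-remove (F ∘ f) ⟩
  F (f e) + sum (removeAt (F ∘ f) e)
    ≡⟨ cong (_+_ (F (f e))) (sum-cong-≗ {m} unchanged) ⟨
  F (f e) + sum (removeAt (F ∘ f′) e)
    ≡⟨ cong (_+_ (F (f e))) (ℤ.+-identityˡ _) ⟨
  F (f e) + (0ℤ + sum (removeAt (F ∘ f′) e))
    ≡⟨ cong (λ z → F (f e) + (z + sum (removeAt (F ∘ f′) e))) F[f′e]≡0 ⟨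
  F (f e) + (F (f′ e) + sum (removeAt (F ∘ f′) e))
    ≡⟨ cong (_+_ (F (f e))) (sum-remove (F ∘ f′)) ⟨
  F (f e) + sum (F ∘ f′)
    ∎
  where
  open ≡-Reasoning
  f′ : Vector ℤ (suc m)
  f′ = updateAt f e (const 0ℤ)
  F[f′e]≡0 : F (f′ e) ≡ 0ℤ
  F[f′e]≡0 = trans (cong F (updateAt-updates e f)) F0≡0
  unchanged : ∀ i → F (f′ (punchIn e i)) ≡ F (f (punchIn e i))
  unchanged i = cong F (updateAt-minimal (punchIn e i) e f (punchInᵢ≢i e i))

∑-distrib-- : ∀ {m} (f g : Vector ℤ m) → sum (λ i → f i - g i) ≡ sum f - sum g
∑-distrib-- f g = begin
  sum (λ i → f i - g i)          ≡⟨ ∑-distrib-+ f (λ i → - g i) ⟩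
  sum f + sum (λ i → - g i)      ≡⟨ cong (_+_ (sum f)) (sum-cong-≗ (λ i → ℤ.-1*i≡-i (g i))) ⟨
  sum f + sum (λ i → -1ℤ * g i)  ≡⟨ cong (_+_ (sum f)) (*-distribˡ-sum -1ℤ g) ⟨
  sum f + -1ℤ * sum g            ≡⟨ cong (_+_ (sum f)) (ℤ.-1*i≡-i (sum g)) ⟩
  sum f - sum g                  ∎
  where open ≡-Reasoning

sum-nonneg : ∀ {m} (f : Vector ℤ m) → (∀ b → 0ℤ ≤ f b) → 0ℤ ≤ sum f
sum-nonneg {zero}  f f≥0 = ℤ.≤-refl
sum-nonneg {suc m} f f≥0 = ℤ.+-mono-≤ (f≥0 Fin.zero) (sum-nonneg (f ∘ Fin.suc) (f≥0 ∘ Fin.suc))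

sum-nonneg-≡0 : ∀ {m} (f : Vector ℤ m) → (∀ b → 0ℤ ≤ f b) → sum f ≡ 0ℤ → ∀ b → f b ≡ 0ℤ
sum-nonneg-≡0 {suc m} f f≥0 Σf≡0 b = ℤ.≤-antisym fb≤0 (f≥0 b)
  where
  instance _ = ℤ.nonNegative (sum-nonneg (removeAt f b) (f≥0 ∘ punchIn b))
  fb≤0 : f b ≤ 0ℤ
  fb≤0 = subst (f b ≤_) (trans (sym (sum-remove f)) Σf≡0) (ℤ.i≤i+j (f b) (sum (removeAt f b)))

δ : ∀ {m} → Fin m → Fin m → ℤ
δ a b with a ≟ b
... | yes _ = 1ℤ
... | no  _ = 0ℤ

δ-≡ : ∀ {m} {a b : Fin m} → a ≡ b → δ a b ≡ 1ℤ
δ-≡ {a = a} {b} a≡b with a ≟ b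
... | yes _   = refl
... | no  a≢b = ⊥-elim (a≢b a≡b)

δ-≢ : ∀ {m} {a b : Fin m} → a ≢ b → δ a b ≡ 0ℤ
δ-≢ {a = a} {b} a≢b with a ≟ b
... | yes a≡b = ⊥-elim (a≢b a≡b)
... | no  _   = refl

sum-δ : ∀ {m} (a : Fin m) → sum (δ a) ≡ 1ℤ
sum-δ a = trans (sum-supportedAt (δ a) a (λ b b≢a → δ-≢ (b≢a ∘ sym))) (δ-≡ refl)

0≤i*i : ∀ i → 0ℤ ≤ i * i
0≤i*i (+ a)    = subst (0ℤ ≤_) (ℤ.pos-* a a) (ℤ.+≤+ z≤n)
0≤i*i -[1+ a ] = ℤ.+≤+ z≤n

i*i≡0⇒i≡0 : ∀ i → i * i ≡ 0ℤ → i ≡ 0ℤ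
i*i≡0⇒i≡0 i i*i≡0 = [ id , id ]′ (ℤ.i*j≡0⇒i≡0∨j≡0 i i*i≡0)

0≤i*i-i : ∀ i → 0ℤ ≤ i * i - i
0≤i*i-i (+ zero)  = ℤ.+≤+ z≤n
0≤i*i-i (+ suc a) = subst (0ℤ ≤_) (sym (shift (+ a))) (ℤ.+-mono-≤ (0≤i*i (+ a)) (ℤ.+≤+ z≤n))
  where
  shift : ∀ A → (1ℤ + A) * (1ℤ + A) - (1ℤ + A) ≡ A * A + A
  shift = solve-∀
0≤i*i-i -[1+ a ]  = ℤ.+≤+ z≤n

2∣i*i-i : ∀ i → + 2 ℤ.∣ i * i - i
2∣i*i-i (+ a)    = 2∣n*n-n a
  where
  shift : ∀ A → (1ℤ + A) * (1ℤ + A) - (1ℤ + A) ≡ (A * A - A) + A * + 2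
  shift = solve-∀
  2∣n*n-n : ∀ a → + 2 ℤ.∣ + a * + a - + a
  2∣n*n-n zero    = ℤ.divides 0ℤ refl
  2∣n*n-n (suc a) = subst (+ 2 ℤ.∣_) (sym (shift (+ a)))
    (ℤ.∣m∣n⇒∣m+n (2∣n*n-n a) (ℤ.∣n⇒∣m*n (+ a) ℤ.∣-refl))
2∣i*i-i -[1+ a ] = subst (+ 2 ℤ.∣_) (sym (negate (+ suc a)))
  (ℤ.∣m∣n⇒∣m+n (2∣i*i-i (+ suc a)) (ℤ.∣n⇒∣m*n (+ suc a) ℤ.∣-refl))
  where
  negate : ∀ B → (- B) * (- B) - (- B) ≡ (B * B - B) + B * + 2
  negate = solve-∀

coprime-* : ∀ {a b n} → Coprime a n → Coprime b n → Coprime (a ℕ.* b) n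
coprime-* {a} a⊥n b⊥n {d} (d∣ab , d∣n) = b⊥n (coprime-divisor d⊥a d∣ab , d∣n)
  where
  d⊥a : Coprime d a
  d⊥a (c∣d , c∣a) = a⊥n (c∣a , ℕ.∣-trans c∣d d∣n)

pred-coprime : ∀ n .{{_ : NonZero n}} → Coprime (pred n) n
pred-coprime n = subst (Coprime (pred n)) (trans (ℕ.+-comm (pred n) 1) (ℕ.suc-pred n))
  (Coprime.sym (Coprime.coprime-+ (Coprime.1-coprimeTo (pred n))))

∃-prime-divisor : ∀ n .{{_ : NonZero n}} → n ≢ 1 → ∃[ p ] Prime p × p ∣ n
∃-prime-divisor n n≢1 with factorise n
... | record { factors = [] ; isFactorisation = n≡1 } = ⊥-elim (n≢1 n≡1)
... | record { factors = p ∷ ps ; isFactorisation = n≡p*ps ; factorsPrime = p-prime ∷ᴬ _ } =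
  p , p-prime , subst (p ∣_) (sym n≡p*ps) (ℕ.m∣m*n (product ps))

prime-∣-* : ∀ {p} → Prime p → ∀ a b → + p ℤ.∣ a * b → + p ℤ.∣ a ⊎ + p ℤ.∣ b
prime-∣-* {p} p-prime a b p∣ab
  with euclidsLemma ∣ a ∣ ∣ b ∣ p-prime (subst (p ∣_) (ℤ.abs-* a b) (ℤ.∣⇒∣ᵤ p∣ab))
... | inj₁ p∣a = inj₁ (ℤ.∣ᵤ⇒∣ p∣a)
... | inj₂ p∣b = inj₂ (ℤ.∣ᵤ⇒∣ p∣b)

pos-^ : ∀ a j → (+ a) ^ j ≡ + (a ℕ.^ j)
pos-^ a zero    = refl
pos-^ a (suc j) = trans (cong (_*_ (+ a)) (pos-^ a j)) (sym (ℤ.pos-* a (a ℕ.^ j)))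

x-y∣xⁿ-yⁿ : ∀ x y n → (x - y) ℤ.∣ x ^ n - y ^ n
x-y∣xⁿ-yⁿ x y zero    = ℤ.divides 0ℤ refl
x-y∣xⁿ-yⁿ x y (suc n) = subst ((x - y) ℤ.∣_) (sym (split x y (x ^ n) (y ^ n)))
  (ℤ.∣m∣n⇒∣m+n (ℤ.∣n⇒∣m*n x (x-y∣xⁿ-yⁿ x y n)) (ℤ.∣m⇒∣m*n (y ^ n) ℤ.∣-refl))
  where
  split : ∀ x y A B → x * A - y * B ≡ x * (A - B) + (x - y) * B
  split = solve-∀

least-witness : ∀ {P : ℕ → Set} → Decidable P → ∀ {n} → P n → ∃[ k ] P k × (∀ {i} → i ℕ.< k → ¬ P i)
least-witness {P} P? {n} = <-rec (λ n → P n → ∃[ k ] P k × (∀ {i} → i ℕ.< k → ¬ P i)) step n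
  where
  step : ∀ n → (∀ {i} → i ℕ.< n → P i → ∃[ k ] P k × (∀ {j} → j ℕ.< k → ¬ P j)) →
         P n → ∃[ k ] P k × (∀ {i} → i ℕ.< k → ¬ P i)
  step n smaller Pn with ℕ.anyUpTo? P? n
  ... | yes (i , i<n , Pi) = smaller i<n Pi
  ... | no  none           = n , Pn , λ i<n Pi → none (_ , i<n , Pi)

-- The multiplicative order of t modulo a prime q

module Order {q : ℕ} (q-prime : Prime q) {t : ℤ} (q∤t : ¬ + q ℤ.∣ t) where

  instance
    q≢0 : NonZero q
    q≢0 = prime⇒nonZero q-prime

  t^_≡1 : ℕ → Set
  t^ j ≡1 = + q ℤ.∣ t ^ j - + 1

  q∣tⁱu⇒q∣u : ∀ i {u} → + q ℤ.∣ t ^ i * u → + q ℤ.∣ u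
  q∣tⁱu⇒q∣u zero    {u} q∣u = subst (+ q ℤ.∣_) (ℤ.*-identityˡ u) q∣u
  q∣tⁱu⇒q∣u (suc i) {u} q∣tⁱ⁺¹u
    with prime-∣-* q-prime t (t ^ i * u) (subst (+ q ℤ.∣_) (ℤ.*-assoc t (t ^ i) u) q∣tⁱ⁺¹u)
  ... | inj₁ q∣t   = ⊥-elim (q∤t q∣t)
  ... | inj₂ q∣tⁱu = q∣tⁱu⇒q∣u i q∣tⁱu

  t^[i+j]≡tⁱ⇒t^j≡1 : ∀ i j → + q ℤ.∣ t ^ (i ℕ.+ j) - t ^ i → t^ j ≡1
  t^[i+j]≡tⁱ⇒t^j≡1 i j q∣diff = q∣tⁱu⇒q∣u i (subst (+ q ℤ.∣_) factor q∣diff)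
    where
    lemma : ∀ A B → A * B - A ≡ A * (B - + 1)
    lemma = solve-∀
    factor : t ^ (i ℕ.+ j) - t ^ i ≡ t ^ i * (t ^ j - + 1)
    factor = trans (cong (_- t ^ i) (ℤ.^-distribˡ-+-* t i j)) (lemma (t ^ i) (t ^ j))

  residue : ℤ → Fin q
  residue z = Fin.fromℕ< (n%ℕd<d z q)

  residue-≡⇒∣ : ∀ a b → residue a ≡ residue b → + q ℤ.∣ b - a
  residue-≡⇒∣ a b same = ℤ.divides (B - A) (begin
    b - a                                  ≡⟨ cong₂ _-_ (a≡a%ℕn+[a/ℕn]*n b q) (a≡a%ℕn+[a/ℕn]*n a q) ⟩
    (+ (b %ℕ q) + B * + q) - (+ (a %ℕ q) + A * + q)
      ≡⟨ cong (λ r → (+ (b %ℕ q) + B * + q) - (+ r + A * + q)) a%q≡b%q ⟩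
    (+ (b %ℕ q) + B * + q) - (+ (b %ℕ q) + A * + q)
      ≡⟨ lemma (+ (b %ℕ q)) B A (+ q) ⟩
    (B - A) * + q                          ∎)
    where
    open ≡-Reasoning
    A B : ℤ
    A = a /ℕ q
    B = b /ℕ q
    a%q≡b%q : a %ℕ q ≡ b %ℕ q
    a%q≡b%q = fromℕ<-injective _ _ (n%ℕd<d a q) (n%ℕd<d b q) same
    lemma : ∀ r B A Q → (r + B * Q) - (r + A * Q) ≡ (B - A) * Q
    lemma = solve-∀

  ∃-small-exponent : ∃[ j ] 0 ℕ.< j × j ℕ.≤ q × t^ j ≡1
  ∃-small-exponent with pigeonhole (ℕ.n<1+n q) (λ (i : Fin (suc q)) → residue (t ^ toℕ i))
  ... | i , j , i<j , same =
    toℕ j ∸ toℕ i , ℕ.m<n⇒0<n∸m i<j , ℕ.≤-trans (ℕ.m∸n≤m (toℕ j) (toℕ i)) (toℕ≤pred[n] j) ,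
    t^[i+j]≡tⁱ⇒t^j≡1 (toℕ i) (toℕ j ∸ toℕ i)
      (subst (λ k → + q ℤ.∣ t ^ k - t ^ toℕ i) (sym (ℕ.m+[n∸m]≡n (ℕ.<⇒≤ i<j)))
        (residue-≡⇒∣ (t ^ toℕ i) (t ^ toℕ j) same))

  ordFrom-least : ∀ fuel k {j} → k ℕ.≤ j → j ℕ.< k ℕ.+ fuel → t^ j ≡1 →
                  k ℕ.≤ ordFrom q t k fuel × t^ ordFrom q t k fuel ≡1 ×
                  (∀ {i} → k ℕ.≤ i → i ℕ.< ordFrom q t k fuel → ¬ t^ i ≡1)
  ordFrom-least zero k k≤j j<k+0 _ =
    ⊥-elim (ℕ.<⇒≱ (subst (_ ℕ.<_) (ℕ.+-identityʳ k) j<k+0) k≤j)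
  ordFrom-least (suc fuel) k {j} k≤j j<k+1+fuel tʲ≡1 with + q ℤ.∣? t ^ k - + 1
  ... | yes tᵏ≡1 = ℕ.≤-refl , tᵏ≡1 , λ k≤i i<k _ → ℕ.<⇒≱ i<k k≤i
  ... | no  tᵏ≢1
    with ordFrom-least fuel (suc k) (ℕ.≤∧≢⇒< k≤j (λ { refl → tᵏ≢1 tʲ≡1 }))
           (subst (j ℕ.<_) (ℕ.+-suc k fuel) j<k+1+fuel) tʲ≡1
  ... | k<o , tᵒ≡1 , below = ℕ.<⇒≤ k<o , tᵒ≡1 , below′
    where
    below′ : ∀ {i} → k ℕ.≤ i → i ℕ.< ordFrom q t (suc k) fuel → ¬ t^ i ≡1
    below′ {i} k≤i i<o with k ℕ.≟ i
    ... | yes refl = tᵏ≢1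
    ... | no  k≢i  = below (ℕ.≤∧≢⇒< k≤i k≢i) i<o

  private
    ord-spec : 0 ℕ.< ord q t × t^ ord q t ≡1 × (∀ {i} → 0 ℕ.< i → i ℕ.< ord q t → ¬ t^ i ≡1)
    ord-spec with ∃-small-exponent
    ... | j , 0<j , j≤q , tʲ≡1 = ordFrom-least q 1 0<j (s≤s j≤q) tʲ≡1

  instance
    ord≢0 : NonZero (ord q t)
    ord≢0 = ℕ.>-nonZero (proj₁ ord-spec)

  t^ord≡1 : t^ ord q t ≡1
  t^ord≡1 = proj₁ (proj₂ ord-spec)

  ord-minimal : ∀ {i} → i ℕ.< ord q t → t^ i ≡1 → i ≡ 0
  ord-minimal {zero}  _   _    = refl
  ord-minimal {suc i} i<o tⁱ≡1 = ⊥-elim (proj₂ (proj₂ ord-spec) (s≤s z≤n) i<o tⁱ≡1)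

  t^[j%ord]≡1 : ∀ {j} → t^ j ≡1 → t^ (j % ord q t) ≡1
  t^[j%ord]≡1 {j} tʲ≡1 = ℤ.∣m+n∣m⇒∣n (subst (+ q ℤ.∣_) decompose tʲ≡1)
    (ℤ.∣n⇒∣m*n (t ^ r) (ℤ.∣-trans t^ord≡1 (subst ((t ^ o - + 1) ℤ.∣_)
      (cong (_-_ ((t ^ o) ^ k)) (ℤ.^-zeroˡ k)) (x-y∣xⁿ-yⁿ (t ^ o) (+ 1) k))))
    where
    o r k : ℕ
    o = ord q t
    r = j % o
    k = j / o
    lemma : ∀ A B → A * B - + 1 ≡ A * (B - + 1) + (A - + 1)
    lemma = solve-∀
    decompose : t ^ j - + 1 ≡ t ^ r * ((t ^ o) ^ k - + 1) + (t ^ r - + 1)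
    decompose = begin
      t ^ j - + 1                                  ≡⟨ cong (λ e → t ^ e - + 1) (ℕ.m≡m%n+[m/n]*n j o) ⟩
      t ^ (r ℕ.+ k ℕ.* o) - + 1                     ≡⟨ cong (_- + 1) (ℤ.^-distribˡ-+-* t r (k ℕ.* o)) ⟩
      t ^ r * t ^ (k ℕ.* o) - + 1                   ≡⟨ cong (λ e → t ^ r * t ^ e - + 1) (ℕ.*-comm k o) ⟩
      t ^ r * t ^ (o ℕ.* k) - + 1                   ≡⟨ cong (λ e → t ^ r * e - + 1) (ℤ.^-*-assoc t o k) ⟨
      t ^ r * (t ^ o) ^ k - + 1                     ≡⟨ lemma (t ^ r) ((t ^ o) ^ k) ⟩
      t ^ r * ((t ^ o) ^ k - + 1) + (t ^ r - + 1)   ∎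
      where open ≡-Reasoning

  ord∣ : ∀ {j} → t^ j ≡1 → ord q t ∣ j
  ord∣ {j} tʲ≡1 = ℕ.m%n≡0⇒n∣m j (ord q t) (ord-minimal (ℕ.m%n<n j (ord q t)) (t^[j%ord]≡1 tʲ≡1))

foldr-gcd∣ : ∀ (xs : List ℕ) {x} → x ∈ xs → foldr gcd 0 xs ∣ x
foldr-gcd∣ (y ∷ xs) (here refl)  = gcd[m,n]∣m y _
foldr-gcd∣ (y ∷ xs) (there x∈xs) = ℕ.∣-trans (gcd[m,n]∣n y _) (foldr-gcd∣ xs x∈xs)

ordGcd∣ord : ∀ {m} .{{_ : NonZero m}} t {q} → Prime q → q ∣ m → ordGcd m t ∣ ord q t
ordGcd∣ord {m} t {q} q-prime q∣m = foldr-gcd∣ _ (∈-map⁺ (λ p → ord p t)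
  (∈-filter⁺ (λ p → prime? p ×-dec p ℕ.∣? m) (∈-upTo⁺ (s≤s (ℕ.∣⇒≤ q∣m))) (q-prime , q∣m)))

-- Multiples in a finite abelian group

module FinAbGroupProperties {m : ℕ} (G : FinAbGroup m) where
  open GroupRing G using (powℕ; powℤ)

  abelianGroup : AbelianGroup 0ℓ 0ℓ
  abelianGroup = record { isAbelianGroup = FinAbGroup.isAbelianGroup G }

  open AbelianGroup abelianGroup public
    using (_∙_; ε; _⁻¹; commutativeMonoid; assoc; identityˡ; identityʳ; inverseˡ; inverseʳ)
  open AbelianGroupProperties abelianGroup public
    using (∙-cancelˡ; ∙-cancelʳ; inverseʳ-unique; x∙y⁻¹≈ε⇒x≈y; ⁻¹-injective)
  open CommutativeMonoidMult commutativeMonoid public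
    using (×-homo-1; ×-homo-+; ×-assocˡ; ×-distrib-+) renaming (_×_ to _×ᴳ_)
  module ∏ = CommutativeMonoidSum commutativeMonoid
  open ≡-Reasoning

  instance
    m≢0 : NonZero m
    m≢0 = nonZeroIndex ε

  powℕ≡×ᴳ : ∀ g k → powℕ g k ≡ k ×ᴳ g
  powℕ≡×ᴳ g zero    = refl
  powℕ≡×ᴳ g (suc k) = cong (g ∙_) (powℕ≡×ᴳ g k)

  ×-ε : ∀ k → k ×ᴳ ε ≡ ε
  ×-ε zero    = refl
  ×-ε (suc k) = trans (identityˡ _) (×-ε k)

  ×-⁻¹ : ∀ k g → k ×ᴳ (g ⁻¹) ≡ (k ×ᴳ g) ⁻¹
  ×-⁻¹ k g = inverseʳ-unique (k ×ᴳ g) (k ×ᴳ (g ⁻¹)) (begin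
    k ×ᴳ g ∙ k ×ᴳ (g ⁻¹)  ≡⟨ ×-distrib-+ g (g ⁻¹) k ⟨
    k ×ᴳ (g ∙ g ⁻¹)       ≡⟨ cong (k ×ᴳ_) (inverseʳ g) ⟩
    k ×ᴳ ε                ≡⟨ ×-ε k ⟩
    ε                     ∎)

  ×-multiple : ∀ c d g → d ×ᴳ g ≡ ε → (c ℕ.* d) ×ᴳ g ≡ ε
  ×-multiple c d g dg = begin
    (c ℕ.* d) ×ᴳ g  ≡⟨ ×-assocˡ g c d ⟨
    c ×ᴳ (d ×ᴳ g)   ≡⟨ cong (c ×ᴳ_) dg ⟩
    c ×ᴳ ε          ≡⟨ ×-ε c ⟩
    ε               ∎

  ×-ε-+ : ∀ a b g → (a ℕ.+ b) ×ᴳ g ≡ ε → b ×ᴳ g ≡ ε → a ×ᴳ g ≡ ε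
  ×-ε-+ a b g abg bg = begin
    a ×ᴳ g           ≡⟨ identityʳ _ ⟨
    a ×ᴳ g ∙ ε       ≡⟨ cong (a ×ᴳ g ∙_) bg ⟨
    a ×ᴳ g ∙ b ×ᴳ g  ≡⟨ ×-homo-+ g a b ⟨
    (a ℕ.+ b) ×ᴳ g   ≡⟨ abg ⟩
    ε                ∎

  gcd×≡ε : ∀ d e g → d ×ᴳ g ≡ ε → e ×ᴳ g ≡ ε → gcd d e ×ᴳ g ≡ ε
  gcd×≡ε d e g dg eg with Bézout.identity (gcd-GCD d e)
  ... | Bézout.+- x y eq =
    ×-ε-+ (gcd d e) (y ℕ.* e) g (trans (cong (_×ᴳ g) eq) (×-multiple x d g dg)) (×-multiple y e g eg)
  ... | Bézout.-+ x y eq =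
    ×-ε-+ (gcd d e) (x ℕ.* d) g (trans (cong (_×ᴳ g) eq) (×-multiple y e g eg)) (×-multiple x d g dg)

  -- Translation by g permutes G, so the product P of all elements satisfies g^|G| P = P.
  lagrange : ∀ g → m ×ᴳ g ≡ ε
  lagrange g = ∙-cancelʳ P (m ×ᴳ g) ε (begin
    m ×ᴳ g ∙ P                 ≡⟨ cong (_∙ P) (∏.sum-replicate m) ⟨
    ∏.sum (replicate m g) ∙ P  ≡⟨ ∏.∑-distrib-+ (replicate m g) id ⟨
    ∏.sum (g ∙_)               ≡⟨ ∏.sum-permute id translation ⟨
    P                          ≡⟨ identityˡ P ⟨
    ε ∙ P                      ∎)
    where
    P : Fin m
    P = ∏.sum id
    translation : Permutation m m
    translation = permutation (g ∙_) (g ⁻¹ ∙_)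
      (λ h → trans (sym (assoc _ _ _)) (trans (cong (_∙ h) (inverseʳ g)) (identityˡ h)))
      (λ h → trans (sym (assoc _ _ _)) (trans (cong (_∙ h) (inverseˡ g)) (identityˡ h)))

  ×-injective : ∀ {r} → Coprime r m → ∀ {a b} → r ×ᴳ a ≡ r ×ᴳ b → a ≡ b
  ×-injective {r} coprime {a} {b} eq = x∙y⁻¹≈ε⇒x≈y a b (begin
    a ∙ b ⁻¹                ≡⟨ ×-homo-1 (a ∙ b ⁻¹) ⟨
    1 ×ᴳ (a ∙ b ⁻¹)         ≡⟨ cong (_×ᴳ (a ∙ b ⁻¹)) (coprime⇒gcd≡1 coprime) ⟨
    gcd r m ×ᴳ (a ∙ b ⁻¹)   ≡⟨ gcd×≡ε r m (a ∙ b ⁻¹) r×≡ε (lagrange (a ∙ b ⁻¹)) ⟩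
    ε                       ∎)
    where
    r×≡ε : r ×ᴳ (a ∙ b ⁻¹) ≡ ε
    r×≡ε = begin
      r ×ᴳ (a ∙ b ⁻¹)       ≡⟨ ×-distrib-+ a (b ⁻¹) r ⟩
      r ×ᴳ a ∙ r ×ᴳ (b ⁻¹)  ≡⟨ cong₂ _∙_ eq (×-⁻¹ r b) ⟩
      r ×ᴳ b ∙ (r ×ᴳ b) ⁻¹  ≡⟨ inverseʳ _ ⟩
      ε                     ∎

  annihilator-prime : ∀ {R b} → b ≢ ε → R ×ᴳ b ≡ ε → ∃[ q ] Prime q × (q ∣ R) × (q ∣ m)
  annihilator-prime {R} {b} b≢ε R×b≡ε with ∃-prime-divisor (gcd R m) {{gcd≢0}} gcd≢1
    where
    gcd≢0 : NonZero (gcd R m)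
    gcd≢0 = ℕ.≢-nonZero (gcd[m,n]≢0 R m (inj₂ (ℕ.≢-nonZero⁻¹ m)))
    gcd≢1 : gcd R m ≢ 1
    gcd≢1 gcd≡1 = b≢ε (begin
      b             ≡⟨ ×-homo-1 b ⟨
      1 ×ᴳ b        ≡⟨ cong (_×ᴳ b) gcd≡1 ⟨
      gcd R m ×ᴳ b  ≡⟨ gcd×≡ε R m b R×b≡ε (lagrange b) ⟩
      ε             ∎)
  ... | q , q-prime , q∣gcd = q , q-prime , ℕ.∣-trans q∣gcd (gcd[m,n]∣m R m) , ℕ.∣-trans q∣gcd (gcd[m,n]∣n R m)

  -- A natural exponent acting as t does; it is congruent to t modulo m but not reduced.
  natExp : ℤ → ℕ
  natExp (+ a)    = a
  natExp -[1+ a ] = suc a ℕ.* pred m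

  powℤ≡natExp×ᴳ : ∀ g t → powℤ g t ≡ natExp t ×ᴳ g
  powℤ≡natExp×ᴳ g (+ a)    = powℕ≡×ᴳ g a
  powℤ≡natExp×ᴳ g -[1+ a ] = begin
    powℕ g (suc a) ⁻¹     ≡⟨ cong _⁻¹ (powℕ≡×ᴳ g (suc a)) ⟩
    (suc a ×ᴳ g) ⁻¹       ≡⟨ inverseʳ-unique (suc a ×ᴳ g) _ (begin
      suc a ×ᴳ g ∙ (suc a ℕ.* pred m) ×ᴳ g  ≡⟨ ×-homo-+ g (suc a) _ ⟨
      (suc a ℕ.+ suc a ℕ.* pred m) ×ᴳ g     ≡⟨ cong (_×ᴳ g) (ℕ.*-suc (suc a) (pred m)) ⟨
      (suc a ℕ.* suc (pred m)) ×ᴳ g         ≡⟨ cong (λ k → (suc a ℕ.* k) ×ᴳ g) (ℕ.suc-pred m) ⟩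
      (suc a ℕ.* m) ×ᴳ g                    ≡⟨ ×-multiple (suc a) m g (lagrange g) ⟩
      ε                                     ∎) ⟨
    natExp -[1+ a ] ×ᴳ g  ∎

  natExp-coprime : ∀ {t} → Coprime ∣ t ∣ m → Coprime (natExp t) m
  natExp-coprime {+ a}      coprime = coprime
  natExp-coprime { -[1+ a ]} coprime = coprime-* coprime (pred-coprime m)

  m∣t-natExp : ∀ t → + m ℤ.∣ t - + natExp t
  m∣t-natExp (+ a)    = ℤ.divides 0ℤ (ℤ.+-inverseʳ (+ a))
  m∣t-natExp -[1+ a ] = ℤ.divides -[1+ a ] (begin
    -[1+ a ] - + (suc a ℕ.* pred m)  ≡⟨ cong (_-_ -[1+ a ]) (ℤ.pos-* (suc a) (pred m)) ⟩
    - + suc a - + suc a * + pred m   ≡⟨ factor (+ suc a) (+ pred m) ⟩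
    - + suc a * (1ℤ + + pred m)      ≡⟨ cong (λ k → -[1+ a ] * + k) (ℕ.suc-pred m) ⟩
    -[1+ a ] * + m                   ∎)
    where
    factor : ∀ A M → - A - A * M ≡ - A * (1ℤ + M)
    factor = solve-∀

module GroupRingProperties {m : ℕ} (G : FinAbGroup m) where
  open GroupRing G
  open FinAbGroupProperties G using (_∙_; ε; _⁻¹; identityʳ; ⁻¹-injective)
  open ≡-Reasoning

  twist-unfold : ∀ s X g → twist s X g ≡ sum (λ h → δ (powℤ h s) g * X h)
  twist-unfold s X g = trans unfold (trans (Σℤ≡sum summand) (sum-cong-≗ pointwise))
    where
    -- `twist` selects its summands with a function local to its where-block,
    -- so the summand is named here by unification.
    summand : Vector ℤ m
    summand = _
    unfold : twist s X g ≡ Σℤ summand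
    unfold = refl
    pointwise : ∀ h → summand h ≡ δ (powℤ h s) g * X h
    pointwise h with powℤ h s ≟ g
    ... | yes _ = sym (ℤ.*-identityˡ (X h))
    ... | no  _ = refl

  twist-image : ∀ s (ψ : Fin m → Fin m) → (∀ {a b} → ψ a ≡ ψ b → a ≡ b) → (∀ h → powℤ h s ≡ ψ h) →
                ∀ X g → twist s X (ψ g) ≡ X g
  twist-image s ψ ψ-injective powℤ≗ψ X g = begin
    twist s X (ψ g)                       ≡⟨ twist-unfold s X (ψ g) ⟩
    sum (λ h → δ (powℤ h s) (ψ g) * X h)  ≡⟨ sum-supportedAt _ g off-g ⟩
    δ (powℤ g s) (ψ g) * X g              ≡⟨ cong (_* X g) (δ-≡ (powℤ≗ψ g)) ⟩
    1ℤ * X g                              ≡⟨ ℤ.*-identityˡ (X g) ⟩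
    X g                                   ∎
    where
    off-g : ∀ h → h ≢ g → δ (powℤ h s) (ψ g) * X h ≡ 0ℤ
    off-g h h≢g = cong (_* X h) (δ-≢ (h≢g ∘ ψ-injective ∘ trans (sym (powℤ≗ψ h))))

  scalar-ε : ∀ c → scalar c ε ≡ c
  scalar-ε c with ε ≟ ε
  ... | yes _   = refl
  ... | no  ε≢ε = ⊥-elim (ε≢ε refl)

  sum-squares : ∀ X c → (X · twist -[1+ 0 ] X) ≋ scalar c → sum (λ h → X h * X h) ≡ c
  sum-squares X c XX*≋c = begin
    sum (λ h → X h * X h)                          ≡⟨ sum-cong-≗ (λ h → cong (X h *_) (twist⁻¹ h)) ⟨
    sum (λ h → X h * twist -[1+ 0 ] X (h ⁻¹ ∙ ε))  ≡⟨ Σℤ≡sum {m} _ ⟨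
    (X · twist -[1+ 0 ] X) ε                       ≡⟨ XX*≋c ε ⟩
    scalar c ε                                     ≡⟨ scalar-ε c ⟩
    c                                              ∎
    where
    twist⁻¹ : ∀ h → twist -[1+ 0 ] X (h ⁻¹ ∙ ε) ≡ X h
    twist⁻¹ h = trans (cong (twist -[1+ 0 ] X) (identityʳ (h ⁻¹)))
      (twist-image -[1+ 0 ] _⁻¹ ⁻¹-injective (λ h → cong _⁻¹ (identityʳ h)) X h)

  ≋scalar : ∀ X c → X ε ≡ c → sum (λ h → X h * X h) ≡ c * c → X ≋ scalar c
  ≋scalar X c Xε≡c ΣX²≡c² g with g ≟ ε
  ... | yes refl = Xε≡c
  ... | no  g≢ε  = trans (sym (updateAt-minimal g ε X g≢ε))
                     (i*i≡0⇒i≡0 (Y g) (sum-nonneg-≡0 (λ h → Y h * Y h) (0≤i*i ∘ Y) ΣY²≡0 g))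
    where
    Y : Vector ℤ m
    Y = updateAt X ε (const 0ℤ)
    ΣY²≡0 : sum (λ h → Y h * Y h) ≡ 0ℤ
    ΣY²≡0 = ℤ+.identityʳ-unique (c * c) _ (begin
      c * c + sum (λ h → Y h * Y h)          ≡⟨ cong (λ a → a * a + sum (λ h → Y h * Y h)) Xε≡c ⟨
      X ε * X ε + sum (λ h → Y h * Y h)      ≡⟨ sum-∘-split (λ z → z * z) refl X ε ⟨
      sum (λ h → X h * X h)                  ≡⟨ ΣX²≡c² ⟩
      c * c                                  ∎)

-- Orbits of a permutation

module Orbits {m : ℕ} (φ : Fin m → Fin m) (φ-injective : ∀ {a b} → φ a ≡ φ b → a ≡ b) where

  φ^ : ℕ → Fin m → Fin m
  φ^ j a = fold a φ j

  φ^-injective : ∀ j {a b} → φ^ j a ≡ φ^ j b → a ≡ b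
  φ^-injective zero    eq = eq
  φ^-injective (suc j) eq = φ^-injective j (φ-injective eq)

  φ^-invariant : ∀ {A : Set} (f : Fin m → A) → (∀ b → f (φ b) ≡ f b) → ∀ j b → f (φ^ j b) ≡ f b
  φ^-invariant f f∘φ≗f zero    b = refl
  φ^-invariant f f∘φ≗f (suc j) b = trans (f∘φ≗f (φ^ j b)) (φ^-invariant f f∘φ≗f j b)

  period-exists : ∀ a → ∃[ s ] 0 ℕ.< s × φ^ s a ≡ a
  period-exists a with pigeonhole (ℕ.n<1+n m) (λ (i : Fin (suc m)) → φ^ (toℕ i) a)
  ... | i , j , i<j , same = toℕ j ∸ toℕ i , ℕ.m<n⇒0<n∸m i<j , φ^-injective (toℕ i) (begin
    φ^ (toℕ i) (φ^ (toℕ j ∸ toℕ i) a)  ≡⟨ fold-+ a φ (toℕ i) ⟨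
    φ^ (toℕ i ℕ.+ (toℕ j ∸ toℕ i)) a   ≡⟨ cong (λ k → φ^ k a) (ℕ.m+[n∸m]≡n (ℕ.<⇒≤ i<j)) ⟩
    φ^ (toℕ j) a                       ≡⟨ same ⟨
    φ^ (toℕ i) a                       ∎)
    where open ≡-Reasoning

  minimal-period : ∀ a → ∃[ s ] (0 ℕ.< s × φ^ s a ≡ a) × (∀ {i} → i ℕ.< s → ¬ (0 ℕ.< i × φ^ i a ≡ a))
  minimal-period a = least-witness (λ s → 0 ℕ.<? s ×-dec φ^ s a ≟ a) (proj₂ (period-exists a))

  period : Fin m → ℕ
  period a = proj₁ (minimal-period a)

  φ^period : ∀ a → φ^ (period a) a ≡ a
  φ^period a = proj₂ (proj₁ (proj₂ (minimal-period a)))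

  orbitCount : ℕ → Fin m → Vector ℤ m
  orbitCount zero    a b = 0ℤ
  orbitCount (suc s) a b = δ (φ^ s a) b + orbitCount s a b

  sum-orbitCount : ∀ s a → sum (orbitCount s a) ≡ + s
  sum-orbitCount zero    a = sum-replicate-zero m
  sum-orbitCount (suc s) a = begin
    sum (orbitCount (suc s) a)               ≡⟨ ∑-distrib-+ (δ (φ^ s a)) (orbitCount s a) ⟩
    sum (δ (φ^ s a)) + sum (orbitCount s a)  ≡⟨ cong₂ _+_ (sum-δ (φ^ s a)) (sum-orbitCount s a) ⟩
    + suc s                                  ∎
    where open ≡-Reasoning

  δ-φ : ∀ a b → δ (φ a) (φ b) ≡ δ a b
  δ-φ a b with a ≟ b
  ... | yes refl = δ-≡ refl
  ... | no  a≢b  = δ-≢ (a≢b ∘ φ-injective)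

  orbitCount-telescope : ∀ s a b → orbitCount s a (φ b) + δ (φ^ s a) (φ b) ≡ δ a (φ b) + orbitCount s a b
  orbitCount-telescope zero    a b = ℤ.+-comm 0ℤ (δ a (φ b))
  orbitCount-telescope (suc s) a b = begin
    (δ (φ^ s a) (φ b) + orbitCount s a (φ b)) + δ (φ (φ^ s a)) (φ b)
      ≡⟨ cong₂ _+_ (ℤ.+-comm (δ (φ^ s a) (φ b)) _) (δ-φ (φ^ s a) b) ⟩
    (orbitCount s a (φ b) + δ (φ^ s a) (φ b)) + δ (φ^ s a) b
      ≡⟨ cong (_+ δ (φ^ s a) b) (orbitCount-telescope s a b) ⟩
    (δ a (φ b) + orbitCount s a b) + δ (φ^ s a) b
      ≡⟨ regroup (δ a (φ b)) (orbitCount s a b) (δ (φ^ s a) b) ⟩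
    δ a (φ b) + (δ (φ^ s a) b + orbitCount s a b)
      ∎
    where
    open ≡-Reasoning
    regroup : ∀ x y z → (x + y) + z ≡ x + (z + y)
    regroup = solve-∀

  orbitCount-φ : ∀ s a → φ^ s a ≡ a → ∀ b → orbitCount s a (φ b) ≡ orbitCount s a b
  orbitCount-φ s a φˢa≡a b = ℤ+.∙-cancelʳ (δ a (φ b)) _ _ (begin
    orbitCount s a (φ b) + δ a (φ b)         ≡⟨ cong (λ c → orbitCount s a (φ b) + δ c (φ b)) φˢa≡a ⟨
    orbitCount s a (φ b) + δ (φ^ s a) (φ b)  ≡⟨ orbitCount-telescope s a b ⟩
    δ a (φ b) + orbitCount s a b             ≡⟨ ℤ.+-comm (δ a (φ b)) _ ⟩
    orbitCount s a b + δ a (φ b)             ∎)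
    where open ≡-Reasoning

  orbitCount-self : ∀ {s a} → 0 ℕ.< s → (∀ {i} → 0 ℕ.< i → i ℕ.< s → φ^ i a ≢ a) →
                    orbitCount s a a ≡ 1ℤ
  orbitCount-self {suc zero}    {a} _ _     = cong (_+ 0ℤ) (δ-≡ {a = a} refl)
  orbitCount-self {suc (suc s)} {a} _ fresh = begin
    δ (φ^ (suc s) a) a + orbitCount (suc s) a a
      ≡⟨ cong (_+ orbitCount (suc s) a a) (δ-≢ (fresh (s≤s z≤n) ℕ.≤-refl)) ⟩
    0ℤ + orbitCount (suc s) a a
      ≡⟨ ℤ.+-identityˡ _ ⟩
    orbitCount (suc s) a a
      ≡⟨ orbitCount-self (s≤s z≤n) (λ 0<i i<s → fresh 0<i (ℕ.m<n⇒m<1+n i<s)) ⟩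
    1ℤ
      ∎
    where open ≡-Reasoning

  orbitCount-support : ∀ s {a b} → orbitCount s a b ≢ 0ℤ → ∃[ k ] φ^ k a ≡ b
  orbitCount-support zero    O≢0 = ⊥-elim (O≢0 refl)
  orbitCount-support (suc s) {a} {b} O≢0 with φ^ s a ≟ b
  ... | yes φˢa≡b = s , φˢa≡b
  ... | no  _     = orbitCount-support s (O≢0 ∘ trans (ℤ.+-identityˡ _))

  orbit : Fin m → Vector ℤ m
  orbit a = orbitCount (period a) a

  orbit-φ : ∀ a b → orbit a (φ b) ≡ orbit a b
  orbit-φ a = orbitCount-φ (period a) a (φ^period a)

  orbit-self : ∀ a → orbit a a ≡ 1ℤ
  orbit-self a with minimal-period a
  ... | s , (0<s , _) , earlier = orbitCount-self 0<s (λ 0<i i<s φⁱa≡a → earlier i<s (0<i , φⁱa≡a))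

  orbit-support : ∀ a {b} → orbit a b ≢ 0ℤ → ∃[ k ] φ^ k a ≡ b
  orbit-support a = orbitCount-support (period a)

  sum-orbit : ∀ a → sum (orbit a) ≡ + period a
  sum-orbit a = sum-orbitCount (period a) a

  module _ (N : ℕ) (D : ℤ) where

    record Admissible (c : Vector ℤ m) : Set where
      field
        invariant : ∀ b → c (φ b) ≡ c b
        divisible : ∀ b → D ℤ.∣ c b
        periodic  : ∀ b j → c b ≢ 0ℤ → φ^ j b ≡ b → N ∣ j

    -- Subtracting c a times the orbit of a clears c on that orbit; the part
    -- removed sums to c a * period a, where N divides the period unless c a = 0.
    module RemoveOrbit {c : Vector ℤ m} (adm : Admissible c) (a : Fin m) where
      open Admissible adm

      c′ : Vector ℤ m
      c′ b = c b - c a * orbit a b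

      sum-c : sum c ≡ sum c′ + c a * + period a
      sum-c = begin
        sum c                                 ≡⟨ sum-cong-≗ (λ b → restore (c b) (c a * orbit a b)) ⟩
        sum (λ b → c′ b + c a * orbit a b)    ≡⟨ ∑-distrib-+ c′ (λ b → c a * orbit a b) ⟩
        sum c′ + sum (λ b → c a * orbit a b)  ≡⟨ cong (_+_ (sum c′)) (*-distribˡ-sum (c a) (orbit a)) ⟨
        sum c′ + c a * sum (orbit a)          ≡⟨ cong (λ o → sum c′ + c a * o) (sum-orbit a) ⟩
        sum c′ + c a * + period a             ∎
        where
        open ≡-Reasoning
        restore : ∀ x y → x ≡ (x - y) + y
        restore = solve-∀

      c′-on-orbit : ∀ b → orbit a b ≢ 0ℤ → c′ b ≡ 0ℤ
      c′-on-orbit b O≢0 with orbit-support a O≢0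
      ... | k , refl = begin
        c (φ^ k a) - c a * orbit a (φ^ k a)  ≡⟨ cong₂ (λ x o → x - c a * o) (φ^-invariant c invariant k a)
                                                  (trans (φ^-invariant (orbit a) (orbit-φ a) k a) (orbit-self a)) ⟩
        c a - c a * 1ℤ                       ≡⟨ cancel (c a) ⟩
        0ℤ                                   ∎
        where
        open ≡-Reasoning
        cancel : ∀ x → x - x * 1ℤ ≡ 0ℤ
        cancel = solve-∀

      off-orbit : ∀ {b} → c′ b ≢ 0ℤ → orbit a b ≡ 0ℤ
      off-orbit {b} c′b≢0 with orbit a b ℤ.≟ 0ℤ
      ... | yes O≡0 = O≡0
      ... | no  O≢0 = ⊥-elim (c′b≢0 (c′-on-orbit b O≢0))

      c′-support : ∀ {b} → c′ b ≢ 0ℤ → c b ≢ 0ℤ × b ≢ a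
      c′-support {b} c′b≢0 =
        subst (_≢ 0ℤ) c′b≡cb c′b≢0 , λ { refl → 1≢0 (trans (sym (orbit-self a)) (off-orbit c′b≢0)) }
        where
        open ≡-Reasoning
        1≢0 : 1ℤ ≢ 0ℤ
        1≢0 ()
        c′b≡cb : c′ b ≡ c b
        c′b≡cb = begin
          c b - c a * orbit a b  ≡⟨ cong (λ o → c b - c a * o) (off-orbit c′b≢0) ⟩
          c b - c a * 0ℤ         ≡⟨ cong (_-_ (c b)) (ℤ.*-zeroʳ (c a)) ⟩
          c b - 0ℤ               ≡⟨ ℤ.+-identityʳ (c b) ⟩
          c b                    ∎

      c′-admissible : Admissible c′
      c′-admissible = record
        { invariant = λ b → cong₂ (λ x o → x - c a * o) (invariant b) (orbit-φ a b)
        ; divisible = λ b → ℤ.∣m∣n⇒∣m-n (divisible b) (ℤ.∣m⇒∣m*n (orbit a b) (divisible a))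
        ; periodic  = λ b j c′b≢0 → periodic b j (proj₁ (c′-support c′b≢0))
        }

      D*N∣orbit-sum : D * + N ℤ.∣ c a * + period a
      D*N∣orbit-sum with c a ℤ.≟ 0ℤ
      ... | yes ca≡0 = subst (λ x → D * + N ℤ.∣ x * + period a) (sym ca≡0) (ℤ.divides 0ℤ refl)
      ... | no  ca≢0 = ℤ.∣-trans (ℤ.*-monoˡ-∣ (+ N) (divisible a))
                         (ℤ.*-monoʳ-∣ (c a) (ℤ.∣ᵤ⇒∣ (periodic a (period a) ca≢0 (φ^period a))))

    sum-divisible-supportedOn : ∀ xs {c} → Admissible c → (∀ b → c b ≢ 0ℤ → b ∈ xs) → D * + N ℤ.∣ sum c
    sum-divisible-supportedOn [] {c} _ supported =
      subst (D * + N ℤ.∣_) (sym (trans (sum-cong-≗ c≗0) (sum-replicate-zero m))) (ℤ.divides 0ℤ refl)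
      where
      c≗0 : ∀ b → c b ≡ 0ℤ
      c≗0 b with c b ℤ.≟ 0ℤ
      ... | yes cb≡0 = cb≡0
      ... | no  cb≢0 with () ← supported b cb≢0
    sum-divisible-supportedOn (a ∷ xs) adm supported = subst (D * + N ℤ.∣_) (sym sum-c)
      (ℤ.∣m∣n⇒∣m+n (sum-divisible-supportedOn xs c′-admissible supported′) D*N∣orbit-sum)
      where
      open RemoveOrbit adm a
      supported′ : ∀ b → c′ b ≢ 0ℤ → b ∈ xs
      supported′ b c′b≢0 with supported b (proj₁ (c′-support c′b≢0))
      ... | here refl  = ⊥-elim (proj₂ (c′-support c′b≢0) refl)
      ... | there b∈xs = b∈xs

    sum-divisible : ∀ {c} → Admissible c → D * + N ℤ.∣ sum c
    sum-divisible adm = sum-divisible-supportedOn (allFin m) adm (λ b _ → ∈-allFin b)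

-- Orbits of h ↦ hᵗ

module PowerOrbits {m : ℕ} (G : FinAbGroup m) {t : ℤ} (t⊥m : Coprime ∣ t ∣ m) where
  open GroupRing G using (twist; _≋_)
  open GroupRingProperties G using (twist-image)
  open FinAbGroupProperties G
  open ≡-Reasoning

  φ : Fin m → Fin m
  φ h = natExp t ×ᴳ h

  φ-injective : ∀ {a b} → φ a ≡ φ b → a ≡ b
  φ-injective = ×-injective (natExp-coprime {t} t⊥m)

  open Orbits φ φ-injective

  φ^≡×ᴳ : ∀ j b → φ^ j b ≡ (natExp t ℕ.^ j) ×ᴳ b
  φ^≡×ᴳ zero    b = sym (×-homo-1 b)
  φ^≡×ᴳ (suc j) b = trans (cong φ (φ^≡×ᴳ j b)) (×-assocˡ b (natExp t) (natExp t ℕ.^ j))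

  q∤t : ∀ {q} → Prime q → q ∣ m → ¬ + q ℤ.∣ t
  q∤t q-prime q∣m q∣t = ℕ.nonTrivial⇒≢1 {{prime⇒nonTrivial q-prime}} (t⊥m (ℤ.∣⇒∣ᵤ q∣t , q∣m))

  q∣tʲ-1 : ∀ {q R} j → q ∣ m → natExp t ℕ.^ j ≡ suc R → q ∣ R → + q ℤ.∣ t ^ j - + 1
  q∣tʲ-1 {q} {R} j q∣m rʲ≡1+R q∣R = subst (+ q ℤ.∣_) (sym split) (ℤ.∣m∣n⇒∣m+n
    (ℤ.∣-trans (ℤ.∣ᵤ⇒∣ q∣m) (ℤ.∣-trans (m∣t-natExp t) (x-y∣xⁿ-yⁿ t (+ r) j)))
    (ℤ.∣ᵤ⇒∣ q∣R))
    where
    r : ℕ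
    r = natExp t
    telescope : ∀ a b → a - + 1 ≡ (a - b) + (b - + 1)
    telescope = solve-∀
    split : t ^ j - + 1 ≡ (t ^ j - (+ r) ^ j) + + R
    split = begin
      t ^ j - + 1                                  ≡⟨ telescope (t ^ j) ((+ r) ^ j) ⟩
      (t ^ j - (+ r) ^ j) + ((+ r) ^ j - + 1)      ≡⟨ cong (λ z → (t ^ j - (+ r) ^ j) + (z - + 1))
                                                           (trans (pos-^ r j) (cong +_ rʲ≡1+R)) ⟩
      (t ^ j - (+ r) ^ j) + (+ suc R - + 1)        ≡⟨ cong (_+_ (t ^ j - (+ r) ^ j)) (ℤ.m-n≡m⊖n (suc R) 1) ⟩
      (t ^ j - (+ r) ^ j) + + R                    ∎

  ordGcd∣period : ∀ {b} → b ≢ ε → ∀ j → φ^ j b ≡ b → ordGcd m t ∣ j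
  ordGcd∣period {b} b≢ε j φʲb≡b with natExp t ℕ.^ j in rʲ≡
  ... | zero  = ⊥-elim (b≢ε (trans (sym φʲb≡b) (trans (φ^≡×ᴳ j b) (cong (_×ᴳ b) rʲ≡))))
  ... | suc R with annihilator-prime b≢ε R×b≡ε
    where
    R×b≡ε : R ×ᴳ b ≡ ε
    R×b≡ε = ∙-cancelˡ b (R ×ᴳ b) ε (begin
      suc R ×ᴳ b               ≡⟨ cong (_×ᴳ b) rʲ≡ ⟨
      (natExp t ℕ.^ j) ×ᴳ b    ≡⟨ φ^≡×ᴳ j b ⟨
      φ^ j b                   ≡⟨ φʲb≡b ⟩
      b                        ≡⟨ identityʳ b ⟨
      b ∙ ε                    ∎)
  ... | q , q-prime , q∣R , q∣m =
    ℕ.∣-trans (ordGcd∣ord t q-prime q∣m) (Order.ord∣ q-prime (q∤t q-prime q∣m) (q∣tʲ-1 j q∣m rʲ≡ q∣R))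

  sum-off-ε-divisible : ∀ (F : ℤ → ℤ) D → F 0ℤ ≡ 0ℤ → (∀ z → D ℤ.∣ F z) → ∀ X → twist t X ≋ X →
                        D * + ordGcd m t ℤ.∣ sum (F ∘ updateAt X ε (const 0ℤ))
  sum-off-ε-divisible F D F0≡0 D∣F X tX≋X = sum-divisible (ordGcd m t) D (record
    { invariant = cong F ∘ Y-invariant
    ; divisible = D∣F ∘ Y
    ; periodic  = λ b j FYb≢0 → ordGcd∣period (λ { refl → FYb≢0 (trans (cong F (updateAt-updates ε X)) F0≡0) }) j
    })
    where
    Y : Vector ℤ m
    Y = updateAt X ε (const 0ℤ)
    X-invariant : ∀ g → X (φ g) ≡ X g
    X-invariant g = trans (sym (tX≋X (φ g))) (twist-image t φ φ-injective (λ h → powℤ≡natExp×ᴳ h t) X g)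
    Y-invariant : ∀ b → Y (φ b) ≡ Y b
    Y-invariant b with b ≟ ε
    ... | yes refl = cong Y (×-ε (natExp t))
    ... | no  b≢ε  = begin
      Y (φ b)  ≡⟨ updateAt-minimal (φ b) ε X (b≢ε ∘ φ-injective ∘ flip trans (sym (×-ε (natExp t)))) ⟩
      X (φ b)  ≡⟨ X-invariant b ⟩
      X b      ≡⟨ updateAt-minimal b ε X b≢ε ⟨
      Y b      ∎

gap≡0-even : ∀ {n x d e} → n ℕ.≤ x → 2 ∣ x → x ∣ d → 2 ℕ.* x ∣ d ℕ.* e →
             d ℕ.+ e ℕ.+ 1 ≡ n ℕ.+ n → d ≡ 0
gap≡0-even _ _ (divides zero d≡0) _ _ = d≡0
gap≡0-even {x = zero} _ _ (divides 1 d≡0) _ _ = d≡0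
gap≡0-even {n} {x = suc x′} {d} {e} _ 2∣x (divides 1 d≡x+0) 2x∣de d+e+1≡2n =
  ⊥-elim (2≢1 (ℕ.∣1⇒≡1 (ℕ.∣m+n∣m⇒∣n 2∣d+e+1 (ℕ.∣m∣n⇒∣m+n 2∣d 2∣e))))
  where
  x : ℕ
  x = suc x′
  2≢1 : 2 ≢ 1
  2≢1 ()
  d≡x : d ≡ x
  d≡x = trans d≡x+0 (ℕ.+-identityʳ x)
  2∣d : 2 ∣ d
  2∣d = subst (2 ∣_) (sym d≡x) 2∣x
  2∣e : 2 ∣ e
  2∣e = ℕ.*-cancelˡ-∣ x (subst₂ _∣_ (ℕ.*-comm 2 x) (cong (ℕ._* e) d≡x) 2x∣de)
  2∣d+e+1 : 2 ∣ d ℕ.+ e ℕ.+ 1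
  2∣d+e+1 = divides n (trans d+e+1≡2n (trans (cong (n ℕ.+_) (sym (ℕ.+-identityʳ n))) (ℕ.*-comm 2 n)))
gap≡0-even {n} {x} {d} {e} n≤x _ (divides (suc (suc u)) d≡) _ d+e+1≡2n = ⊥-elim (ℕ.<⇒≱ d<2n 2n≤d)
  where
  d<2n : d ℕ.< n ℕ.+ n
  d<2n = subst (d ℕ.<_) d+e+1≡2n (ℕ.≤-<-trans (ℕ.m≤m+n d e) (ℕ.m<m+n (d ℕ.+ e) (s≤s z≤n)))
  2n≤d : n ℕ.+ n ℕ.≤ d
  2n≤d = subst (n ℕ.+ n ℕ.≤_) (sym d≡) (ℕ.+-mono-≤ n≤x (ℕ.≤-trans n≤x (ℕ.m≤m+n x (u ℕ.* x))))

nonneg-factor : ∀ d z → 0ℤ ≤ + suc d * z → ∃[ e ] z ≡ + e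
nonneg-factor d (+ e)    _  = e , refl
nonneg-factor d -[1+ e ] ()

gap≡0 : ∀ {n x} D → 0 ℕ.< n → + x ℤ.∣ D → + (2 ℕ.* x) ℤ.∣ D * (+ (n ℕ.+ n) - D - + 1) →
               0ℤ ≤ D * (+ (n ℕ.+ n) - D - + 1) → D < + x ⊎ (n ℕ.≤ x × 2 ∣ x) → D ≡ 0ℤ
gap≡0 (+ zero) _ _ _ _ _ = refl
gap≡0 {suc n′} -[1+ k ] _ _ _ 0≤DE _ =
  ⊥-elim (0≰-[1+_] (subst (0ℤ ≤_) (negative (+ suc n′) (+ k)) 0≤DE))
  where
  0≰-[1+_] : ∀ {j} → ¬ 0ℤ ≤ -[1+ j ]
  0≰-[1+_] ()
  negative : ∀ N K → - (1ℤ + K) * ((N + N) - - (1ℤ + K) - + 1) ≡ - ((1ℤ + K) * (N + N + K))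
  negative = solve-∀
gap≡0 {n} {x} (+ suc d) _ x∣D 2x∣DE 0≤DE condition with nonneg-factor d _ 0≤DE
... | e , E≡e with condition
...   | inj₁ D<x         = ⊥-elim (ℕ.<⇒≱ (ℤ.drop‿+<+ D<x) (ℕ.∣⇒≤ (ℤ.∣⇒∣ᵤ x∣D)))
...   | inj₂ (n≤x , 2∣x) = cong +_ (gap≡0-even n≤x 2∣x (ℤ.∣⇒∣ᵤ x∣D) 2x∣de d+e+1≡2n)
  where
  2x∣de : 2 ℕ.* x ∣ suc d ℕ.* e
  2x∣de = ℤ.∣⇒∣ᵤ (subst (+ (2 ℕ.* x) ℤ.∣_)
    (trans (cong (_*_ (+ suc d)) E≡e) (sym (ℤ.pos-* (suc d) e))) 2x∣DE)
  regroup : ∀ A B → A ≡ B + (A - B - + 1) + + 1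
  regroup = solve-∀
  d+e+1≡2n : suc d ℕ.+ e ℕ.+ 1 ≡ n ℕ.+ n
  d+e+1≡2n = ℤ.+-injective (sym (trans (regroup (+ (n ℕ.+ n)) (+ suc d)) (cong (λ w → + suc d + w + + 1) E≡e)))

identity-coefficient : ∀ {n x} {a₀ S Q : ℤ} → 0 ℕ.< n → a₀ + S ≡ + n → a₀ * a₀ + Q ≡ + (n ℕ.* n) →
                       + x ℤ.∣ S → + (2 ℕ.* x) ℤ.∣ Q - S → 0ℤ ≤ Q - S →
                       + n - a₀ < + x ⊎ (n ℕ.≤ x × 2 ∣ x) → a₀ ≡ + n
identity-coefficient {n} {x} {a₀} {S} {Q} 0<n a₀+S≡n a₀²+Q≡n² x∣S 2x∣Q-S 0≤Q-S condition = begin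
  a₀        ≡⟨ recover (+ n) a₀ ⟩
  + n - D   ≡⟨ cong (_-_ (+ n)) D≡0 ⟩
  + n - 0ℤ  ≡⟨ ℤ.+-identityʳ (+ n) ⟩
  + n       ∎
  where
  open ≡-Reasoning
  D : ℤ
  D = + n - a₀
  isolate : ∀ a s → s ≡ (a + s) - a
  isolate = solve-∀
  recover : ∀ N a → a ≡ N - (N - a)
  recover = solve-∀
  difference : ∀ N a → (N * N - a * a) - (N - a) ≡ (N - a) * ((N + N) - (N - a) - + 1)
  difference = solve-∀
  S≡D : S ≡ D
  S≡D = trans (isolate a₀ S) (cong (_- a₀) a₀+S≡n)
  Q-S≡ : Q - S ≡ D * (+ (n ℕ.+ n) - D - + 1)
  Q-S≡ = trans (cong₂ _-_ (trans (isolate (a₀ * a₀) Q) (cong (_- a₀ * a₀) (trans a₀²+Q≡n² (ℤ.pos-* n n)))) S≡D)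
               (difference (+ n) a₀)
  D≡0 : D ≡ 0ℤ
  D≡0 = gap≡0 D 0<n (subst (+ x ℤ.∣_) S≡D x∣S) (subst (+ (2 ℕ.* x) ℤ.∣_) Q-S≡ 2x∣Q-S)
          (subst (0ℤ ≤_) Q-S≡ 0≤Q-S) condition

lemma17 : (m : ℕ) (G : FinAbGroup m) (t : ℤ) → Coprime ∣ t ∣ m →
    (X : ZG m) (n : ℕ) → 1 ℕ.≤ n →
    GroupRing._≋_ G (GroupRing.twist G t X) X →
    GroupRing.aug G X ≡ + n →
    GroupRing._≋_ G (GroupRing._·_ G X (GroupRing.twist G -[1+ 0 ] X)) (GroupRing.scalar G (+ (n ℕ.* n))) →
    ((+ n ℤ.< + ordGcd m t × (+ n ℤ.- X (FinAbGroup.ε G)) ℤ.< + ordGcd m t)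
    ⊎ (n ℕ.≤ ordGcd m t × 2 ∣ ordGcd m t)) →
    GroupRing._≋_ G X (GroupRing.scalar G (+ n))
lemma17 m G t t⊥m X n 0<n tX≋X |X|≡n XX*≋n² condition =
  ≋scalar X (+ n) a₀≡n (trans ΣX²≡n² (ℤ.pos-* n n))
  where
  open FinAbGroupProperties G using (ε)
  open GroupRingProperties G using (sum-squares; ≋scalar)
  open PowerOrbits G {t} t⊥m using (sum-off-ε-divisible)
  x : ℕ
  x = ordGcd m t
  Y : Vector ℤ m
  Y = updateAt X ε (const 0ℤ)
  ΣX²≡n² : sum (λ h → X h * X h) ≡ + (n ℕ.* n)
  ΣX²≡n² = sum-squares X _ XX*≋n²
  ΣY²-Y≡ : sum (λ b → Y b * Y b - Y b) ≡ sum (λ b → Y b * Y b) - sum Y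
  ΣY²-Y≡ = ∑-distrib-- (λ b → Y b * Y b) Y
  a₀≡n : X ε ≡ + n
  a₀≡n = identity-coefficient 0<n
    (trans (sym (sum-∘-split id refl X ε)) (trans (sym (Σℤ≡sum X)) |X|≡n))
    (trans (sym (sum-∘-split (λ z → z * z) refl X ε)) ΣX²≡n²)
    (subst (ℤ._∣ sum Y) (ℤ.*-identityˡ (+ x))
      (sum-off-ε-divisible id 1ℤ refl (λ z → ℤ.divides z (sym (ℤ.*-identityʳ z))) X tX≋X))
    (subst₂ ℤ._∣_ (sym (ℤ.pos-* 2 x)) ΣY²-Y≡ (sum-off-ε-divisible (λ z → z * z - z) (+ 2) refl 2∣i*i-i X tX≋X))
    (subst (0ℤ ≤_) ΣY²-Y≡ (sum-nonneg _ (0≤i*i-i ∘ Y)))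
    (map₁ proj₂ condition)
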